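{- The vertical half $V$ of the Riordan array $(1-x^2,\ x(1+x)^2)$ is the Catalan matrix $V=(c(x)^2,\ xc(x)^2)$. The corresponding horizontal half $H$ is $H=(c(x)^2,\ xc(x)^4)$.
   Context: All power series are formal power series with complex coefficients. A Riordan array is a pair $(g(x),f(x))$ of power series with $g(0)\neq 0$, $f(0)=0$, $f'(0)\neq 0$; it is identified with the infinite lower triangular matrix $(t_{n,k})_{n,k\ge 0}$, $t_{n,k}=[x^n]g(x)f(x)^k$. The vertical half of a Riordan array with matrix $(t_{n,k})$ is the matrix whose $(n,k)$ entry is $t_{2n-k,n}$ (with $t_{i,j}=0$ for $j>i$); the horizontal half is the matrix whose $(n,k)$ entry is $t_{2n,n+k}$. Here $c(x)=\frac{1-\sqrt{1-4x}}{2x}$ is the generating function of the Catalan numbers. -}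

module Defs where

open import Data.Nat as ℕ using (ℕ; zero; suc; _∸_; _≤?_)
open import Data.Nat.DivMod using (_/_)
open import Data.Nat.Combinatorics using (_C_)
open import Data.Integer using (ℤ; +_; _+_; _*_; -_; _-_)
open import Relation.Nullary using (yes; no)

-- Formal power series with integer coefficients (all series in the
-- statement have integer coefficients; ℤ ⊂ ℂ), given by coefficient
-- function: a n = [x^n] a.
Series : Set
Series = ℕ → ℤ

sumTo : ℕ → (ℕ → ℤ) → ℤ
sumTo zero    f = f 0
sumTo (suc n) f = sumTo n f + f (suc n)

𝟙 : Series
𝟙 zero    = + 1
𝟙 (suc _) = + 0

X : Series
X 1 = + 1
X _ = + 0

_⊕_ : Series → Series → Series
(a ⊕ b) n = a n + b n

_⊖_ : Series → Series → Series
(a ⊖ b) n = a n - b n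

_⊛_ : Series → Series → Series
(a ⊛ b) n = sumTo n (λ i → a i * b (n ∸ i))

infixl 6 _⊕_ _⊖_
infixl 7 _⊛_

_^ₛ_ : Series → ℕ → Series
a ^ₛ zero  = 𝟙
a ^ₛ suc k = a ⊛ (a ^ₛ k)

catalan : ℕ → ℕ
catalan n = ((2 ℕ.* n) C n) / suc n

c : Series
c n = + catalan n

riordan : Series → Series → ℕ → ℕ → ℤ
riordan g f n k = (g ⊛ (f ^ₛ k)) n

-- Vertical half of a matrix t: (n,k) ↦ t_{2n-k,n}, with the entry 0
-- when 2n-k < 0 (and t_{i,j} = 0 for j > i, automatic for Riordan arrays).
verticalHalf : (ℕ → ℕ → ℤ) → ℕ → ℕ → ℤ
verticalHalf t n k with k ≤? 2 ℕ.* n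
... | yes _ = t (2 ℕ.* n ∸ k) n
... | no  _ = + 0

horizontalHalf : (ℕ → ℕ → ℤ) → ℕ → ℕ → ℤ
horizontalHalf t n k = t (2 ℕ.* n) (n ℕ.+ k)

gA : Series
gA = 𝟙 ⊖ X ⊛ X

fA : Series
fA = X ⊛ ((𝟙 ⊕ X) ^ₛ 2)

module Submission where

-- Writing f = x h, column k of the Riordan array (g, f) is x^k g h^k, so all four arrays are
-- lower triangular and it suffices to compare the entries (k + d, k). For (1 - x², x(1 + x)²)
-- the column g h^j is (1 - x)(1 + x)^(2j+1), with coefficients C(2j+1, d) - C(2j+1, d-1).
-- On the other side the columns are x^k c^(2+kp), and since c = 1 + x c² the ballot numbers
-- [x^d] c^(s+1) satisfy the same Pascal recursion as C(2d+s, d) - C(2d+s, d-1), which vanishes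
-- in the middle of each row by symmetry; both halves then compare the same binomial differences.
-- For s = 0 this also identifies [x^m] c with C(2m, m)/(m + 1), via (m+1) C(2m, m-1) = m C(2m, m).

open import Defs
open import Data.Nat as ℕ using (ℕ; zero; suc; _∸_; _≤_; _<_; s≤s; _≤?_)
open import Data.Nat.Properties
  using (+-suc; +-comm; +-identityʳ; +-commutativeSemigroup; *-zeroʳ; *-identityʳ; *-distribˡ-+; m≤m+n; m+n∸m≡n; m≤n⇒∃[o]m+o≡n; ≤-<-connex; +-monoʳ-<; ∸-monoʳ-<; ≤-trans; module ≤-Reasoning)
open import Data.Nat.Combinatorics using (_C_; nCk+nC[k+1]≡[n+1]C[k+1]; nCk≡nC[n∸k]; nC1≡n)
open import Data.Nat.DivMod using (_/_; m*n/n≡m)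
open import Data.Integer using (ℤ; +_; _+_; _*_; _-_)
import Data.Integer.Properties as ℤ
open import Data.Integer.Tactic.RingSolver using (solve-∀)
import Data.Nat.Tactic.RingSolver as ℕ-Solver
open import Algebra.Properties.CommutativeSemigroup +-commutativeSemigroup using (x∙yz≈y∙xz)
open import Data.Product using (_×_; _,_)
open import Data.Sum using (inj₁; inj₂)
open import Function using (_∘_)
open import Relation.Binary.PropositionalEquality
open import Relation.Nullary using (yes; no; contradiction)
import Relation.Binary.Reasoning.Setoid as SetoidReasoning

module ≗-Reasoning = SetoidReasoning (ℕ →-setoid ℤ)

sumTo-cong : ∀ n {f g : ℕ → ℤ} → f ≗ g → sumTo n f ≡ sumTo n g
sumTo-cong zero    f≗g = f≗g 0
sumTo-cong (suc n) f≗g = cong₂ _+_ (sumTo-cong n f≗g) (f≗g (suc n))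

sumTo-zero : ∀ n {f : ℕ → ℤ} → (∀ i → f i ≡ + 0) → sumTo n f ≡ + 0
sumTo-zero zero    f≡0 = f≡0 0
sumTo-zero (suc n) f≡0 = cong₂ _+_ (sumTo-zero n f≡0) (f≡0 (suc n))

sumTo-unfoldˡ : ∀ n (f : ℕ → ℤ) → sumTo (suc n) f ≡ f 0 + sumTo n (f ∘ suc)
sumTo-unfoldˡ zero    f = refl
sumTo-unfoldˡ (suc n) f = begin
  sumTo (suc n) f + f (suc (suc n))            ≡⟨ cong (_+ f (suc (suc n))) (sumTo-unfoldˡ n f) ⟩
  f 0 + sumTo n (f ∘ suc) + f (suc (suc n))    ≡⟨ ℤ.+-assoc (f 0) _ _ ⟩
  f 0 + (sumTo n (f ∘ suc) + f (suc (suc n)))  ∎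
  where open ≡-Reasoning

sumTo-+ : ∀ n (f g : ℕ → ℤ) → sumTo n (λ i → f i + g i) ≡ sumTo n f + sumTo n g
sumTo-+ zero    f g = refl
sumTo-+ (suc n) f g =
  trans (cong (_+ (f (suc n) + g (suc n))) (sumTo-+ n f g))
        (interchange (sumTo n f) (sumTo n g) (f (suc n)) (g (suc n)))
  where
  interchange : ∀ x y z w → (x + y) + (z + w) ≡ (x + z) + (y + w)
  interchange = solve-∀

sumTo-minus : ∀ n (f g : ℕ → ℤ) → sumTo n (λ i → f i - g i) ≡ sumTo n f - sumTo n g
sumTo-minus zero    f g = refl
sumTo-minus (suc n) f g =
  trans (cong (_+ (f (suc n) - g (suc n))) (sumTo-minus n f g))
        (interchange (sumTo n f) (sumTo n g) (f (suc n)) (g (suc n)))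
  where
  interchange : ∀ x y z w → (x - y) + (z - w) ≡ (x + z) - (y + w)
  interchange = solve-∀

tail : Series → Series
tail a = a ∘ suc

⊛-congˡ : ∀ {a a′} b → a ≗ a′ → a ⊛ b ≗ a′ ⊛ b
⊛-congˡ b a≗a′ n = sumTo-cong n (λ i → cong (_* b (n ∸ i)) (a≗a′ i))

⊛-congʳ : ∀ a {b b′} → b ≗ b′ → a ⊛ b ≗ a ⊛ b′
⊛-congʳ a b≗b′ n = sumTo-cong n (λ i → cong (a i *_) (b≗b′ (n ∸ i)))

⊛-suc : ∀ a b n → (a ⊛ b) (suc n) ≡ a 0 * b (suc n) + (tail a ⊛ b) n
⊛-suc a b n = sumTo-unfoldˡ n (λ i → a i * b (suc n ∸ i))

⊛-distribˡ-⊕ : ∀ a b b′ → a ⊛ (b ⊕ b′) ≗ a ⊛ b ⊕ a ⊛ b′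
⊛-distribˡ-⊕ a b b′ n =
  trans (sumTo-cong n (λ i → ℤ.*-distribˡ-+ (a i) (b (n ∸ i)) (b′ (n ∸ i)))) (sumTo-+ n _ _)

⊛-distribʳ-⊖ : ∀ a a′ b → (a ⊖ a′) ⊛ b ≗ a ⊛ b ⊖ a′ ⊛ b
⊛-distribʳ-⊖ a a′ b n =
  trans (sumTo-cong n (λ i → distribʳ (a i) (a′ i) (b (n ∸ i)))) (sumTo-minus n _ _)
  where
  distribʳ : ∀ x y z → (x - y) * z ≡ x * z - y * z
  distribʳ = solve-∀

⊛-identityˡ : ∀ b → 𝟙 ⊛ b ≗ b
⊛-identityˡ b zero    = ℤ.*-identityˡ (b 0)
⊛-identityˡ b (suc n) = begin
  (𝟙 ⊛ b) (suc n)                   ≡⟨ ⊛-suc 𝟙 b n ⟩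
  + 1 * b (suc n) + (tail 𝟙 ⊛ b) n  ≡⟨ cong₂ _+_ (ℤ.*-identityˡ (b (suc n))) tail𝟙⊛b≡0 ⟩
  b (suc n) + + 0                   ≡⟨ ℤ.+-identityʳ (b (suc n)) ⟩
  b (suc n)                         ∎
  where
  open ≡-Reasoning
  tail𝟙⊛b≡0 : (tail 𝟙 ⊛ b) n ≡ + 0
  tail𝟙⊛b≡0 = sumTo-zero n (λ i → ℤ.*-zeroˡ (b (n ∸ i)))

⊛-identityʳ : ∀ a → a ⊛ 𝟙 ≗ a
⊛-identityʳ a zero    = ℤ.*-identityʳ (a 0)
⊛-identityʳ a (suc n) = begin
  (a ⊛ 𝟙) (suc n)             ≡⟨ ⊛-suc a 𝟙 n ⟩
  a 0 * + 0 + (tail a ⊛ 𝟙) n  ≡⟨ cong₂ _+_ (ℤ.*-zeroʳ (a 0)) (⊛-identityʳ (tail a) n) ⟩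
  + 0 + a (suc n)             ≡⟨ ℤ.+-identityˡ (a (suc n)) ⟩
  a (suc n)                   ∎
  where open ≡-Reasoning

X⊛-zero : ∀ b → (X ⊛ b) 0 ≡ + 0
X⊛-zero b = ℤ.*-zeroˡ (b 0)

X⊛-suc : ∀ b n → (X ⊛ b) (suc n) ≡ b n
X⊛-suc b n = begin
  (X ⊛ b) (suc n)                   ≡⟨ ⊛-suc X b n ⟩
  + 0 * b (suc n) + (tail X ⊛ b) n  ≡⟨ cong₂ _+_ (ℤ.*-zeroˡ (b (suc n))) (⊛-congˡ b tailX≗𝟙 n) ⟩
  + 0 + (𝟙 ⊛ b) n                   ≡⟨ ℤ.+-identityˡ _ ⟩
  (𝟙 ⊛ b) n                         ≡⟨ ⊛-identityˡ b n ⟩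
  b n                               ∎
  where
  open ≡-Reasoning
  tailX≗𝟙 : tail X ≗ 𝟙
  tailX≗𝟙 zero    = refl
  tailX≗𝟙 (suc i) = refl

X⊛-assoc : ∀ a b → (X ⊛ a) ⊛ b ≗ X ⊛ (a ⊛ b)
X⊛-assoc a b zero = begin
  (X ⊛ a) 0 * b 0  ≡⟨ cong (_* b 0) (X⊛-zero a) ⟩
  + 0 * b 0        ≡⟨ ℤ.*-zeroˡ (b 0) ⟩
  + 0              ≡⟨ X⊛-zero (a ⊛ b) ⟨
  (X ⊛ (a ⊛ b)) 0  ∎
  where open ≡-Reasoning
X⊛-assoc a b (suc n) = begin
  ((X ⊛ a) ⊛ b) (suc n)
    ≡⟨ ⊛-suc (X ⊛ a) b n ⟩
  (X ⊛ a) 0 * b (suc n) + (tail (X ⊛ a) ⊛ b) n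
    ≡⟨ cong₂ _+_ (cong (_* b (suc n)) (X⊛-zero a)) (⊛-congˡ b (X⊛-suc a) n) ⟩
  + 0 * b (suc n) + (a ⊛ b) n
    ≡⟨ cong (_+ (a ⊛ b) n) (ℤ.*-zeroˡ (b (suc n))) ⟩
  + 0 + (a ⊛ b) n
    ≡⟨ ℤ.+-identityˡ _ ⟩
  (a ⊛ b) n
    ≡⟨ X⊛-suc (a ⊛ b) n ⟨
  (X ⊛ (a ⊛ b)) (suc n)
    ∎
  where open ≡-Reasoning

⊛-X⊛-suc : ∀ a b n → (a ⊛ (X ⊛ b)) (suc n) ≡ (a ⊛ b) n
⊛-X⊛-suc a b zero = begin
  (a ⊛ (X ⊛ b)) 1                    ≡⟨ ⊛-suc a (X ⊛ b) 0 ⟩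
  a 0 * (X ⊛ b) 1 + a 1 * (X ⊛ b) 0  ≡⟨ cong₂ (λ u v → a 0 * u + a 1 * v) (X⊛-suc b 0) (X⊛-zero b) ⟩
  a 0 * b 0 + a 1 * + 0              ≡⟨ cong (_+_ (a 0 * b 0)) (ℤ.*-zeroʳ (a 1)) ⟩
  a 0 * b 0 + + 0                    ≡⟨ ℤ.+-identityʳ _ ⟩
  (a ⊛ b) 0                          ∎
  where open ≡-Reasoning
⊛-X⊛-suc a b (suc n) = begin
  (a ⊛ (X ⊛ b)) (suc (suc n))
    ≡⟨ ⊛-suc a (X ⊛ b) (suc n) ⟩
  a 0 * (X ⊛ b) (suc (suc n)) + (tail a ⊛ (X ⊛ b)) (suc n)
    ≡⟨ cong₂ _+_ (cong (a 0 *_) (X⊛-suc b (suc n))) (⊛-X⊛-suc (tail a) b n) ⟩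
  a 0 * b (suc n) + (tail a ⊛ b) n
    ≡⟨ ⊛-suc a b n ⟨
  (a ⊛ b) (suc n)
    ∎
  where open ≡-Reasoning

⊛-X⊛ : ∀ a b → a ⊛ (X ⊛ b) ≗ X ⊛ (a ⊛ b)
⊛-X⊛ a b zero    = trans (cong (a 0 *_) (X⊛-zero b)) (trans (ℤ.*-zeroʳ (a 0)) (sym (X⊛-zero (a ⊛ b))))
⊛-X⊛ a b (suc n) = trans (⊛-X⊛-suc a b n) (sym (X⊛-suc (a ⊛ b) n))

^ₛ-cong : ∀ k {a a′} → a ≗ a′ → a ^ₛ k ≗ a′ ^ₛ k
^ₛ-cong zero    a≗a′ n = refl
^ₛ-cong (suc k) {a} {a′} a≗a′ n =
  trans (⊛-congˡ (a ^ₛ k) a≗a′ n) (⊛-congʳ a′ (^ₛ-cong k a≗a′) n)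

mulXPow : ℕ → Series → Series
mulXPow zero    b = b
mulXPow (suc k) b = X ⊛ mulXPow k b

mulXPow-+ : ∀ k b d → mulXPow k b (k ℕ.+ d) ≡ b d
mulXPow-+ zero    b d = refl
mulXPow-+ (suc k) b d = trans (X⊛-suc (mulXPow k b) (k ℕ.+ d)) (mulXPow-+ k b d)

mulXPow-< : ∀ k b {n} → n < k → mulXPow k b n ≡ + 0
mulXPow-< (suc k) b {zero}  _         = X⊛-zero (mulXPow k b)
mulXPow-< (suc k) b {suc n} (s≤s n<k) = trans (X⊛-suc (mulXPow k b) n) (mulXPow-< k b n<k)

⊛-mulXPow : ∀ k a b → a ⊛ mulXPow k b ≗ mulXPow k (a ⊛ b)
⊛-mulXPow zero    a b n = refl
⊛-mulXPow (suc k) a b n = trans (⊛-X⊛ a (mulXPow k b) n) (⊛-congʳ X (⊛-mulXPow k a b) n)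

X⊛-^ₛ : ∀ h k → (X ⊛ h) ^ₛ k ≗ mulXPow k (h ^ₛ k)
X⊛-^ₛ h zero    = λ _ → refl
X⊛-^ₛ h (suc k) = begin
  (X ⊛ h) ⊛ (X ⊛ h) ^ₛ k        ≈⟨ ⊛-congʳ (X ⊛ h) (X⊛-^ₛ h k) ⟩
  (X ⊛ h) ⊛ mulXPow k (h ^ₛ k)  ≈⟨ X⊛-assoc h (mulXPow k (h ^ₛ k)) ⟩
  X ⊛ (h ⊛ mulXPow k (h ^ₛ k))  ≈⟨ ⊛-congʳ X (⊛-mulXPow k h (h ^ₛ k)) ⟩
  X ⊛ mulXPow k (h ⊛ h ^ₛ k)    ∎
  where open ≗-Reasoning

LowerTriangular : (ℕ → ℕ → ℤ) → Set
LowerTriangular t = ∀ {n k} → n < k → t n k ≡ + 0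

lowerTriangular-≡ : ∀ {s t} → LowerTriangular s → LowerTriangular t →
                    (∀ k d → s (k ℕ.+ d) k ≡ t (k ℕ.+ d) k) → ∀ n k → s n k ≡ t n k
lowerTriangular-≡ {s} {t} s-lower t-lower on-or-below n k with ≤-<-connex k n
... | inj₁ k≤n = let d , k+d≡n = m≤n⇒∃[o]m+o≡n k≤n in
                 subst (λ m → s m k ≡ t m k) k+d≡n (on-or-below k d)
... | inj₂ n<k = trans (s-lower n<k) (sym (t-lower n<k))

riordan-X⊛ : ∀ g h k → (λ n → riordan g (X ⊛ h) n k) ≗ mulXPow k (g ⊛ h ^ₛ k)
riordan-X⊛ g h k = begin
  g ⊛ (X ⊛ h) ^ₛ k        ≈⟨ ⊛-congʳ g (X⊛-^ₛ h k) ⟩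
  g ⊛ mulXPow k (h ^ₛ k)  ≈⟨ ⊛-mulXPow k g (h ^ₛ k) ⟩
  mulXPow k (g ⊛ h ^ₛ k)  ∎
  where open ≗-Reasoning

riordan-X⊛-+ : ∀ g h k d → riordan g (X ⊛ h) (k ℕ.+ d) k ≡ (g ⊛ h ^ₛ k) d
riordan-X⊛-+ g h k d = trans (riordan-X⊛ g h k (k ℕ.+ d)) (mulXPow-+ k (g ⊛ h ^ₛ k) d)

riordan-X⊛-lowerTriangular : ∀ g h → LowerTriangular (riordan g (X ⊛ h))
riordan-X⊛-lowerTriangular g h {n} {k} n<k =
  trans (riordan-X⊛ g h k n) (mulXPow-< k (g ⊛ h ^ₛ k) n<k)

verticalHalf-≤ : ∀ t {n k} → k ≤ 2 ℕ.* n → verticalHalf t n k ≡ t (2 ℕ.* n ∸ k) n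
verticalHalf-≤ t {n} {k} k≤2n with k ≤? 2 ℕ.* n
... | yes _   = refl
... | no k≰2n = contradiction k≤2n k≰2n

verticalHalf-lowerTriangular : ∀ {t} → LowerTriangular t → LowerTriangular (verticalHalf t)
verticalHalf-lowerTriangular {t} t-lower {n} {k} n<k with k ≤? 2 ℕ.* n
... | no _    = refl
... | yes k≤2n = t-lower (begin-strict
  2 ℕ.* n ∸ k  <⟨ ∸-monoʳ-< n<k k≤2n ⟩
  2 ℕ.* n ∸ n  ≡⟨ m+n∸m≡n n (n ℕ.+ 0) ⟩
  n ℕ.+ 0      ≡⟨ +-identityʳ n ⟩
  n            ∎)
  where open ≤-Reasoning

horizontalHalf-lowerTriangular : ∀ {t} → LowerTriangular t → LowerTriangular (horizontalHalf t)
horizontalHalf-lowerTriangular {t} t-lower {n} {k} n<k = t-lower (begin-strict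
  2 ℕ.* n  ≡⟨ cong (n ℕ.+_) (+-identityʳ n) ⟩
  n ℕ.+ n  <⟨ +-monoʳ-< n n<k ⟩
  n ℕ.+ k  ∎)
  where open ≤-Reasoning

verticalHalf-+ : ∀ t k d → verticalHalf t (k ℕ.+ d) k ≡ t (k ℕ.+ d ℕ.+ d) (k ℕ.+ d)
verticalHalf-+ t k d =
  trans (verticalHalf-≤ t (≤-trans (m≤m+n k d) (m≤m+n (k ℕ.+ d) (k ℕ.+ d ℕ.+ 0))))
        (cong (λ m → t m (k ℕ.+ d)) (trans (cong (_∸ k) (index k d)) (m+n∸m≡n k (k ℕ.+ d ℕ.+ d))))
  where
  index : ∀ k d → 2 ℕ.* (k ℕ.+ d) ≡ k ℕ.+ (k ℕ.+ d ℕ.+ d)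
  index = ℕ-Solver.solve-∀

horizontalHalf-+ : ∀ t k d → horizontalHalf t (k ℕ.+ d) k ≡ t (k ℕ.+ d ℕ.+ k ℕ.+ d) (k ℕ.+ d ℕ.+ k)
horizontalHalf-+ t k d = cong (λ m → t m (k ℕ.+ d ℕ.+ k)) (index k d)
  where
  index : ∀ k d → 2 ℕ.* (k ℕ.+ d) ≡ k ℕ.+ d ℕ.+ k ℕ.+ d
  index = ℕ-Solver.solve-∀

-- F r plays the role of G(x)^r for the series G = 1 + x G^q.
module PowerFamily (q : ℕ) (F : ℕ → Series)
                   (F-zero : F 0 ≗ 𝟙)
                   (F-suc : ∀ r → F (suc r) ≗ F r ⊕ X ⊛ F (q ℕ.+ r)) where

  mutual
    ⊛-+ : ∀ a b → F a ⊛ F b ≗ F (a ℕ.+ b)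
    ⊛-+ a zero n = begin
      (F a ⊛ F 0) n  ≡⟨ ⊛-congʳ (F a) F-zero n ⟩
      (F a ⊛ 𝟙) n    ≡⟨ ⊛-identityʳ (F a) n ⟩
      F a n          ≡⟨ cong (λ r → F r n) (+-identityʳ a) ⟨
      F (a ℕ.+ 0) n  ∎
      where open ≡-Reasoning
    ⊛-+ a (suc b) n = begin
      (F a ⊛ F (suc b)) n
        ≡⟨ ⊛-congʳ (F a) (F-suc b) n ⟩
      (F a ⊛ (F b ⊕ X ⊛ F (q ℕ.+ b))) n
        ≡⟨ ⊛-distribˡ-⊕ (F a) (F b) (X ⊛ F (q ℕ.+ b)) n ⟩
      (F a ⊛ F b) n + (F a ⊛ (X ⊛ F (q ℕ.+ b))) n
        ≡⟨ cong₂ _+_ (⊛-+ a b n) (trans (⊛-X⊛ (F a) (F (q ℕ.+ b)) n) (X⊛-⊛-+ a (q ℕ.+ b) n)) ⟩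
      F (a ℕ.+ b) n + (X ⊛ F (a ℕ.+ (q ℕ.+ b))) n
        ≡⟨ cong (λ r → F (a ℕ.+ b) n + (X ⊛ F r) n) (x∙yz≈y∙xz a q b) ⟩
      F (a ℕ.+ b) n + (X ⊛ F (q ℕ.+ (a ℕ.+ b))) n
        ≡⟨ F-suc (a ℕ.+ b) n ⟨
      F (suc (a ℕ.+ b)) n
        ≡⟨ cong (λ r → F r n) (+-suc a b) ⟨
      F (a ℕ.+ suc b) n
        ∎
      where open ≡-Reasoning

    -- ⊛-+ under X ⊛, proved pointwise so that the recursion only uses coefficients below n.
    X⊛-⊛-+ : ∀ a b n → (X ⊛ (F a ⊛ F b)) n ≡ (X ⊛ F (a ℕ.+ b)) n
    X⊛-⊛-+ a b zero    = trans (X⊛-zero (F a ⊛ F b)) (sym (X⊛-zero (F (a ℕ.+ b))))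
    X⊛-⊛-+ a b (suc n) = trans (X⊛-suc (F a ⊛ F b) n) (trans (⊛-+ a b n) (sym (X⊛-suc (F (a ℕ.+ b)) n)))

  ^ₛ-* : ∀ p k → F p ^ₛ k ≗ F (k ℕ.* p)
  ^ₛ-* p zero    n = sym (F-zero n)
  ^ₛ-* p (suc k) n = trans (⊛-congʳ (F p) (^ₛ-* p k) n) (⊛-+ p (k ℕ.* p) n)

C-pascal : ∀ n k → suc n C suc k ≡ n C k ℕ.+ n C suc k
C-pascal n k = sym (nCk+nC[k+1]≡[n+1]C[k+1] n k)

C-sym : ∀ a b → (a ℕ.+ b) C a ≡ (a ℕ.+ b) C b
C-sym a b = trans (nCk≡nC[n∸k] (m≤m+n a b)) (cong ((a ℕ.+ b) C_) (m+n∸m≡n a b))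

C-absorption : ∀ n k → suc k ℕ.* (suc n C suc k) ≡ suc n ℕ.* (n C k)
C-absorption zero    zero    = refl
C-absorption zero    (suc k) = *-zeroʳ (suc (suc k))
C-absorption (suc n) zero    = trans (+-identityʳ _) (trans (nC1≡n (suc (suc n))) (sym (*-identityʳ (suc (suc n)))))
C-absorption (suc n) (suc k) = begin
  suc (suc k) ℕ.* (suc (suc n) C suc (suc k))
    ≡⟨ cong (suc (suc k) ℕ.*_) (C-pascal (suc n) (suc k)) ⟩
  suc (suc k) ℕ.* (x ℕ.+ suc n C suc (suc k))
    ≡⟨ split k x (suc n C suc (suc k)) ⟩
  x ℕ.+ (suc k ℕ.* x ℕ.+ suc (suc k) ℕ.* (suc n C suc (suc k)))
    ≡⟨ cong₂ (λ u v → x ℕ.+ (u ℕ.+ v)) (C-absorption n k) (C-absorption n (suc k)) ⟩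
  x ℕ.+ (suc n ℕ.* (n C k) ℕ.+ suc n ℕ.* (n C suc k))
    ≡⟨ cong (x ℕ.+_) (*-distribˡ-+ (suc n) (n C k) (n C suc k)) ⟨
  x ℕ.+ suc n ℕ.* (n C k ℕ.+ n C suc k)
    ≡⟨ cong (λ u → x ℕ.+ suc n ℕ.* u) (C-pascal n k) ⟨
  suc (suc n) ℕ.* x
    ∎
  where
  open ≡-Reasoning
  x : ℕ
  x = suc n C suc k
  split : ∀ j u v → suc (suc j) ℕ.* (u ℕ.+ v) ≡ u ℕ.+ (suc j ℕ.* u ℕ.+ suc (suc j) ℕ.* v)
  split = ℕ-Solver.solve-∀

central-balance : ∀ m → suc (suc m) ℕ.* (suc (m ℕ.+ suc m) C m) ≡ suc m ℕ.* (suc (m ℕ.+ suc m) C suc m)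
central-balance m = begin
  suc (suc m) ℕ.* (M C m)
    ≡⟨ cong (λ M′ → suc (suc m) ℕ.* (M′ C m)) (+-suc m (suc m)) ⟨
  suc (suc m) ℕ.* ((m ℕ.+ suc (suc m)) C m)
    ≡⟨ cong (suc (suc m) ℕ.*_) (C-sym m (suc (suc m))) ⟩
  suc (suc m) ℕ.* ((m ℕ.+ suc (suc m)) C suc (suc m))
    ≡⟨ cong (λ M′ → suc (suc m) ℕ.* (M′ C suc (suc m))) (+-suc m (suc m)) ⟩
  suc (suc m) ℕ.* (M C suc (suc m))
    ≡⟨ C-absorption N (suc m) ⟩
  M ℕ.* (N C suc m)
    ≡⟨ cong (M ℕ.*_) (C-sym m (suc m)) ⟨
  M ℕ.* (N C m)
    ≡⟨ C-absorption N m ⟨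
  suc m ℕ.* (M C suc m)
    ∎
  where
  open ≡-Reasoning
  N M : ℕ
  N = m ℕ.+ suc m
  M = suc N

binomials : ℕ → Series
binomials M i = + (M C i)

binomials-zero : binomials 0 ≗ 𝟙
binomials-zero zero    = refl
binomials-zero (suc i) = refl

binomials-suc : ∀ M → binomials (suc M) ≗ binomials M ⊕ X ⊛ binomials M
binomials-suc M zero    = sym (cong (_+_ (+ 1)) (X⊛-zero (binomials M)))
binomials-suc M (suc i) = begin
  + (suc M C suc i)                          ≡⟨ cong +_ (trans (C-pascal M i) (+-comm (M C i) (M C suc i))) ⟩
  + (M C suc i) + + (M C i)                  ≡⟨ cong (_+_ (+ (M C suc i))) (X⊛-suc (binomials M) i) ⟨
  + (M C suc i) + (X ⊛ binomials M) (suc i)  ∎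
  where open ≡-Reasoning

module Binomials = PowerFamily 0 binomials binomials-zero binomials-suc

1+X-^ₛ-2 : (𝟙 ⊕ X) ^ₛ 2 ≗ binomials 2
1+X-^ₛ-2 n = trans (^ₛ-cong 2 1+X≗binomials-1 n) (Binomials.^ₛ-* 1 2 n)
  where
  1+X≗binomials-1 : 𝟙 ⊕ X ≗ binomials 1
  1+X≗binomials-1 zero          = refl
  1+X≗binomials-1 (suc zero)    = refl
  1+X≗binomials-1 (suc (suc i)) = refl

-- ballot m r is [x^m] c(x)^r: the recursion is c^(r+1) = c^r + x c^(r+2), i.e. c = 1 + x c².
ballot : ℕ → ℕ → ℕ
ballot zero    r       = 1
ballot (suc m) zero    = 0
ballot (suc m) (suc r) = ballot (suc m) r ℕ.+ ballot m (suc (suc r))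

catalanPowers : ℕ → Series
catalanPowers r m = + ballot m r

catalanPowers-zero : catalanPowers 0 ≗ 𝟙
catalanPowers-zero zero    = refl
catalanPowers-zero (suc m) = refl

catalanPowers-suc : ∀ r → catalanPowers (suc r) ≗ catalanPowers r ⊕ X ⊛ catalanPowers (2 ℕ.+ r)
catalanPowers-suc r zero    = sym (cong (_+_ (+ 1)) (X⊛-zero (catalanPowers (2 ℕ.+ r))))
catalanPowers-suc r (suc m) = sym (cong (_+_ (catalanPowers r (suc m))) (X⊛-suc (catalanPowers (2 ℕ.+ r)) m))

module CatalanPowers = PowerFamily 2 catalanPowers catalanPowers-zero catalanPowers-suc

-- Δbinom M d is [x^d] (1 - x)(1 + x)^M.
Δbinom : ℕ → Series
Δbinom M zero    = + 1
Δbinom M (suc d) = + (M C suc d) - + (M C d)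

Δbinom-pascal : ∀ M d → Δbinom (suc M) (suc d) ≡ Δbinom M (suc d) + Δbinom M d
Δbinom-pascal M zero = begin
  + (suc M C 1) - + 1    ≡⟨ cong (λ u → + u - + 1) (C-pascal M 0) ⟩
  + 1 + + (M C 1) - + 1  ≡⟨ regroup (+ (M C 1)) ⟩
  + (M C 1) - + 1 + + 1  ∎
  where
  open ≡-Reasoning
  regroup : ∀ x → + 1 + x - + 1 ≡ x - + 1 + + 1
  regroup = solve-∀
Δbinom-pascal M (suc d) = begin
  + (suc M C suc (suc d)) - + (suc M C suc d)
    ≡⟨ cong₂ (λ u v → + u - + v) (C-pascal M (suc d)) (C-pascal M d) ⟩
  + (M C suc d) + + (M C suc (suc d)) - (+ (M C d) + + (M C suc d))
    ≡⟨ telescope (+ (M C d)) (+ (M C suc d)) (+ (M C suc (suc d))) ⟩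
  + (M C suc (suc d)) - + (M C suc d) + (+ (M C suc d) - + (M C d))
    ∎
  where
  open ≡-Reasoning
  telescope : ∀ x y z → y + z - (x + y) ≡ z - y + (y - x)
  telescope = solve-∀

Δbinom-middle : ∀ m → Δbinom (suc m ℕ.+ m) (suc m) ≡ + 0
Δbinom-middle m = trans (cong (λ u → + u - + ((suc m ℕ.+ m) C m)) (C-sym (suc m) m))
                        (ℤ.+-inverseʳ (+ ((suc m ℕ.+ m) C m)))

gA-⊛ : ∀ a → gA ⊛ a ≗ a ⊖ X ⊛ (X ⊛ a)
gA-⊛ a n = trans (⊛-distribʳ-⊖ 𝟙 (X ⊛ X) a n) (cong₂ _-_ (⊛-identityˡ a n) (X⊛-assoc X a n))

gA-⊛-binomials : ∀ M → gA ⊛ binomials M ≗ Δbinom (suc M)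
gA-⊛-binomials M zero    = trans (gA-⊛ (binomials M) 0) (cong (λ u → + 1 - u) (X⊛-zero (X ⊛ binomials M)))
gA-⊛-binomials M (suc d) = begin
  (gA ⊛ B) (suc d)                     ≡⟨ gA-⊛ B (suc d) ⟩
  B (suc d) - (X ⊛ (X ⊛ B)) (suc d)    ≡⟨ cong (λ u → B (suc d) - u) (X⊛-suc (X ⊛ B) d) ⟩
  B (suc d) - (X ⊛ B) d                ≡⟨ cancel (B d) (B (suc d)) ((X ⊛ B) d) ⟨
  B (suc d) + B d - (B d + (X ⊛ B) d)  ≡⟨ cong₂ _-_ B′-suc (binomials-suc M d) ⟨
  Δbinom (suc M) (suc d)               ∎
  where
  open ≡-Reasoning
  B : Series
  B = binomials M
  B′-suc : binomials (suc M) (suc d) ≡ B (suc d) + B d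
  B′-suc = trans (binomials-suc M (suc d)) (cong (_+_ (B (suc d))) (X⊛-suc B d))
  cancel : ∀ x y z → y + x - (x + z) ≡ y - z
  cancel = solve-∀

catalanPowers-closed : ∀ m s → catalanPowers (suc s) m ≡ Δbinom (m ℕ.+ m ℕ.+ s) m
catalanPowers-closed zero    s       = refl
catalanPowers-closed (suc m) zero    = begin
  catalanPowers 2 m                                      ≡⟨ catalanPowers-closed m 1 ⟩
  Δbinom (m ℕ.+ m ℕ.+ 1) m                               ≡⟨ cong (λ M → Δbinom M m) (index₁ m) ⟩
  Δbinom (suc m ℕ.+ m) m                                 ≡⟨ ℤ.+-identityˡ _ ⟨
  + 0 + Δbinom (suc m ℕ.+ m) m                           ≡⟨ cong (_+ Δbinom (suc m ℕ.+ m) m) (Δbinom-middle m) ⟨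
  Δbinom (suc m ℕ.+ m) (suc m) + Δbinom (suc m ℕ.+ m) m  ≡⟨ Δbinom-pascal (suc m ℕ.+ m) m ⟨
  Δbinom (suc (suc m ℕ.+ m)) (suc m)                     ≡⟨ cong (λ M → Δbinom M (suc m)) (index₂ m) ⟩
  Δbinom (suc m ℕ.+ suc m ℕ.+ 0) (suc m)                 ∎
  where
  open ≡-Reasoning
  index₁ : ∀ m → m ℕ.+ m ℕ.+ 1 ≡ suc m ℕ.+ m
  index₁ = ℕ-Solver.solve-∀
  index₂ : ∀ m → suc (suc m ℕ.+ m) ≡ suc m ℕ.+ suc m ℕ.+ 0
  index₂ = ℕ-Solver.solve-∀
catalanPowers-closed (suc m) (suc s) = begin
  catalanPowers (suc s) (suc m) + catalanPowers (3 ℕ.+ s) m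
    ≡⟨ cong₂ _+_ (catalanPowers-closed (suc m) s) (catalanPowers-closed m (2 ℕ.+ s)) ⟩
  Δbinom M (suc m) + Δbinom (m ℕ.+ m ℕ.+ (2 ℕ.+ s)) m
    ≡⟨ cong (λ M′ → Δbinom M (suc m) + Δbinom M′ m) (index₁ m s) ⟩
  Δbinom M (suc m) + Δbinom M m
    ≡⟨ Δbinom-pascal M m ⟨
  Δbinom (suc M) (suc m)
    ≡⟨ cong (λ M′ → Δbinom M′ (suc m)) (index₂ m s) ⟩
  Δbinom (suc m ℕ.+ suc m ℕ.+ suc s) (suc m)
    ∎
  where
  open ≡-Reasoning
  M : ℕ
  M = suc m ℕ.+ suc m ℕ.+ s
  index₁ : ∀ m s → m ℕ.+ m ℕ.+ (2 ℕ.+ s) ≡ suc m ℕ.+ suc m ℕ.+ s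
  index₁ = ℕ-Solver.solve-∀
  index₂ : ∀ m s → suc (suc m ℕ.+ suc m ℕ.+ s) ≡ suc m ℕ.+ suc m ℕ.+ suc s
  index₂ = ℕ-Solver.solve-∀

Δbinom-central : ∀ m → Δbinom (m ℕ.+ m) m * + suc m ≡ + ((m ℕ.+ m) C m)
Δbinom-central zero    = refl
Δbinom-central (suc m) = cancel (+ (M C suc m)) (+ (M C m)) (+ suc m) balance
  where
  M : ℕ
  M = suc (m ℕ.+ suc m)
  balance : + suc (suc m) * + (M C m) ≡ + suc m * + (M C suc m)
  balance = trans (sym (ℤ.pos-* (suc (suc m)) (M C m)))
                  (trans (cong +_ (central-balance m)) (ℤ.pos-* (suc m) (M C suc m)))
  cancel : ∀ x y s → (+ 1 + s) * y ≡ s * x → (x - y) * (+ 1 + s) ≡ x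
  cancel x y s eq = begin
    (x - y) * (+ 1 + s)          ≡⟨ expand x y s ⟩
    x + (s * x - (+ 1 + s) * y)  ≡⟨ cong (λ u → x + (s * x - u)) eq ⟩
    x + (s * x - s * x)          ≡⟨ collapse x s ⟩
    x                            ∎
    where
    open ≡-Reasoning
    expand : ∀ x y s → (x - y) * (+ 1 + s) ≡ x + (s * x - (+ 1 + s) * y)
    expand = solve-∀
    collapse : ∀ x s → x + (s * x - s * x) ≡ x
    collapse = solve-∀

catalan≡ballot : ∀ m → catalan m ≡ ballot m 1
catalan≡ballot m = begin
  ((m ℕ.+ (m ℕ.+ 0)) C m) / suc m  ≡⟨ cong (λ u → ((m ℕ.+ u) C m) / suc m) (+-identityʳ m) ⟩
  ((m ℕ.+ m) C m) / suc m          ≡⟨ cong (_/ suc m) ballot-times ⟨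
  (ballot m 1 ℕ.* suc m) / suc m   ≡⟨ m*n/n≡m (ballot m 1) (suc m) ⟩
  ballot m 1                       ∎
  where
  open ≡-Reasoning
  ballot-times : ballot m 1 ℕ.* suc m ≡ (m ℕ.+ m) C m
  ballot-times = ℤ.+-injective (begin
    + (ballot m 1 ℕ.* suc m)            ≡⟨ ℤ.pos-* (ballot m 1) (suc m) ⟩
    catalanPowers 1 m * + suc m         ≡⟨ cong (_* + suc m) (catalanPowers-closed m 0) ⟩
    Δbinom (m ℕ.+ m ℕ.+ 0) m * + suc m  ≡⟨ cong (λ M → Δbinom M m * + suc m) (+-identityʳ (m ℕ.+ m)) ⟩
    Δbinom (m ℕ.+ m) m * + suc m        ≡⟨ Δbinom-central m ⟩
    + ((m ℕ.+ m) C m)                   ∎)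

c-^ₛ : ∀ r → c ^ₛ r ≗ catalanPowers r
c-^ₛ r n = begin
  (c ^ₛ r) n                 ≡⟨ ^ₛ-cong r (λ m → cong +_ (catalan≡ballot m)) n ⟩
  (catalanPowers 1 ^ₛ r) n   ≡⟨ CatalanPowers.^ₛ-* 1 r n ⟩
  catalanPowers (r ℕ.* 1) n  ≡⟨ cong (λ r′ → catalanPowers r′ n) (*-identityʳ r) ⟩
  catalanPowers r n          ∎
  where open ≡-Reasoning

gA-column : ∀ j → gA ⊛ ((𝟙 ⊕ X) ^ₛ 2) ^ₛ j ≗ Δbinom (suc (j ℕ.* 2))
gA-column j = begin
  gA ⊛ ((𝟙 ⊕ X) ^ₛ 2) ^ₛ j  ≈⟨ ⊛-congʳ gA (^ₛ-cong j 1+X-^ₛ-2) ⟩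
  gA ⊛ binomials 2 ^ₛ j     ≈⟨ ⊛-congʳ gA (Binomials.^ₛ-* 2 j) ⟩
  gA ⊛ binomials (j ℕ.* 2)  ≈⟨ gA-⊛-binomials (j ℕ.* 2) ⟩
  Δbinom (suc (j ℕ.* 2))    ∎
  where open ≗-Reasoning

catalan-column : ∀ p k → c ^ₛ 2 ⊛ (c ^ₛ p) ^ₛ k ≗ catalanPowers (2 ℕ.+ k ℕ.* p)
catalan-column p k = begin
  c ^ₛ 2 ⊛ (c ^ₛ p) ^ₛ k                     ≈⟨ ⊛-congˡ ((c ^ₛ p) ^ₛ k) (c-^ₛ 2) ⟩
  catalanPowers 2 ⊛ (c ^ₛ p) ^ₛ k            ≈⟨ ⊛-congʳ (catalanPowers 2) (^ₛ-cong k (c-^ₛ p)) ⟩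
  catalanPowers 2 ⊛ catalanPowers p ^ₛ k     ≈⟨ ⊛-congʳ (catalanPowers 2) (CatalanPowers.^ₛ-* p k) ⟩
  catalanPowers 2 ⊛ catalanPowers (k ℕ.* p)  ≈⟨ CatalanPowers.⊛-+ 2 (k ℕ.* p) ⟩
  catalanPowers (2 ℕ.+ k ℕ.* p)              ∎
  where open ≗-Reasoning

riordanA-+ : ∀ j d → riordan gA fA (j ℕ.+ d) j ≡ Δbinom (suc (j ℕ.* 2)) d
riordanA-+ j d = trans (riordan-X⊛-+ gA ((𝟙 ⊕ X) ^ₛ 2) j d) (gA-column j d)

riordanCatalan-+ : ∀ p k d → riordan (c ^ₛ 2) (X ⊛ c ^ₛ p) (k ℕ.+ d) k ≡ Δbinom (d ℕ.+ d ℕ.+ suc (k ℕ.* p)) d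
riordanCatalan-+ p k d =
  trans (riordan-X⊛-+ (c ^ₛ 2) (c ^ₛ p) k d)
        (trans (catalan-column p k d) (catalanPowers-closed d (suc (k ℕ.* p))))

verticalHalfA-+ : ∀ k d → verticalHalf (riordan gA fA) (k ℕ.+ d) k ≡ riordan (c ^ₛ 2) (X ⊛ c ^ₛ 2) (k ℕ.+ d) k
verticalHalfA-+ k d = begin
  verticalHalf (riordan gA fA) (k ℕ.+ d) k   ≡⟨ verticalHalf-+ (riordan gA fA) k d ⟩
  riordan gA fA (k ℕ.+ d ℕ.+ d) (k ℕ.+ d)    ≡⟨ riordanA-+ (k ℕ.+ d) d ⟩
  Δbinom (suc ((k ℕ.+ d) ℕ.* 2)) d           ≡⟨ cong (λ M → Δbinom M d) (index k d) ⟩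
  Δbinom (d ℕ.+ d ℕ.+ suc (k ℕ.* 2)) d       ≡⟨ riordanCatalan-+ 2 k d ⟨
  riordan (c ^ₛ 2) (X ⊛ c ^ₛ 2) (k ℕ.+ d) k  ∎
  where
  open ≡-Reasoning
  index : ∀ k d → suc ((k ℕ.+ d) ℕ.* 2) ≡ d ℕ.+ d ℕ.+ suc (k ℕ.* 2)
  index = ℕ-Solver.solve-∀

horizontalHalfA-+ : ∀ k d → horizontalHalf (riordan gA fA) (k ℕ.+ d) k ≡ riordan (c ^ₛ 2) (X ⊛ c ^ₛ 4) (k ℕ.+ d) k
horizontalHalfA-+ k d = begin
  horizontalHalf (riordan gA fA) (k ℕ.+ d) k           ≡⟨ horizontalHalf-+ (riordan gA fA) k d ⟩
  riordan gA fA (k ℕ.+ d ℕ.+ k ℕ.+ d) (k ℕ.+ d ℕ.+ k)  ≡⟨ riordanA-+ (k ℕ.+ d ℕ.+ k) d ⟩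
  Δbinom (suc ((k ℕ.+ d ℕ.+ k) ℕ.* 2)) d               ≡⟨ cong (λ M → Δbinom M d) (index k d) ⟩
  Δbinom (d ℕ.+ d ℕ.+ suc (k ℕ.* 4)) d                 ≡⟨ riordanCatalan-+ 4 k d ⟨
  riordan (c ^ₛ 2) (X ⊛ c ^ₛ 4) (k ℕ.+ d) k            ∎
  where
  open ≡-Reasoning
  index : ∀ k d → suc ((k ℕ.+ d ℕ.+ k) ℕ.* 2) ≡ d ℕ.+ d ℕ.+ suc (k ℕ.* 4)
  index = ℕ-Solver.solve-∀

mainTheorem11 : ((n k : ℕ) → verticalHalf (riordan gA fA) n k ≡ riordan (c ^ₛ 2) (X ⊛ (c ^ₛ 2)) n k)
                × ((n k : ℕ) → horizontalHalf (riordan gA fA) n k ≡ riordan (c ^ₛ 2) (X ⊛ (c ^ₛ 4)) n k)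
mainTheorem11 =
    lowerTriangular-≡ (verticalHalf-lowerTriangular A-lower) (riordan-X⊛-lowerTriangular (c ^ₛ 2) (c ^ₛ 2))
                      verticalHalfA-+
  , lowerTriangular-≡ (horizontalHalf-lowerTriangular A-lower) (riordan-X⊛-lowerTriangular (c ^ₛ 2) (c ^ₛ 4))
                      horizontalHalfA-+
  where
  A-lower : LowerTriangular (riordan gA fA)
  A-lower = riordan-X⊛-lowerTriangular gA ((𝟙 ⊕ X) ^ₛ 2)
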